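{- Let $w$ be an excursion. Then the map $\Phi(w)$ is well defined: during the computation of $\varphi_w(M^0_\bullet)$, every time the operation $\varphi_c$ has to be applied its defining condition is satisfied, and the tree-growing map $\varphi_w(M^0_\bullet)$ has exactly one leg besides the head, this leg and the head both lying in the head-face (so they can be glued together).
   Context: Words are on $\{a,b,c\}$; $|w|_\alpha$ is the number of occurrences of $\alpha$ in $w$. An excursion is a word $w$ such that every prefix $w'$ satisfies $|w'|_a+|w'|_b\leq 2|w'|_c$ and $|w|_a+|w|_b=2|w|_c$. Maps: a planar map is a connected planar graph (loops, multiple edges allowed) embedded in the sphere up to orientation-preserving homeomorphism; edges consist of two half-edges each incident to one endpoint. A rooted map has a distinguished half-edge (the root), whose endpoint is the root-vertex. A growing map is a rooted map together with some legs (half-edges not belonging to a complete edge), one leg being distinguished as the head, all legs lying in one face called the head-face; the endpoint of the head is the head-vertex; the root may itself be a leg. A tree-growing map $M_T$ is a growing map $M$ with a distinguished spanning tree $T$. For vertices $u,v$, $u$ is an ancestor of $v$ (and $v$ a descendant of $u$) if $u$ lies on the path in $T$ from the root-vertex to $v$; $u,v$ are comparable if one is an ancestor of the other. Making the tour of the head-face means following its border counterclockwise (the face on the left) starting from the head; this linearly orders the legs other than the head, giving the first and the last leg. Operations: $M^0_\bullet$ is the tree-growing map with one vertex and two legs, one being the root and the other the head, the tree being the single vertex. $\varphi_a(M_T)$ (resp. $\varphi_b(M_T)$) is obtained by replacing the head by a complete edge $e$ from the head-vertex to a new vertex $v$, which carries the new head and one further leg placed immediately at the left (resp. right) of the new head;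 the tree becomes $T\cup\{e,v\}$. $\varphi_c(M_T)$ is defined only if the first and last legs exist and have distinct and comparable endpoints; calling them $s,t$ with the endpoint of $s$ an ancestor of the endpoint of $t$, $\varphi_c(M_T)$ is obtained by gluing the head and $s$ into an edge, while $t$ becomes the new head; $T$ is unchanged. For $w=a_1a_2\cdots a_m$, $\varphi_w=\varphi_{a_1}\circ\varphi_{a_2}\circ\cdots\circ\varphi_{a_m}$ (letters applied from right to left). For an excursion $w$, $\Phi(w)$ is obtained from $\varphi_w(M^0_\bullet)$ by gluing the head and the remaining leg into a marked edge. -}

module Defs where

open import Data.Nat using (ℕ; zero; suc; _+_; _*_; _≤_; _<_; _≡ᵇ_)
open import Data.Bool using (Bool; true; false; if_then_else_)
open import Data.List using (List; []; _∷_; take; filterᵇ) renaming (head to headL; last to lastL)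
open import Data.List.Membership.Propositional using (_∈_)
open import Data.Maybe using (Maybe; just; nothing)
open import Data.Product using (Σ; _×_; _,_)
open import Data.Sum using (_⊎_)
open import Relation.Binary.PropositionalEquality using (_≡_; _≢_)

data Letter : Set where
  a b c : Letter

_≟L_ : Letter → Letter → Bool
a ≟L a = true
b ≟L b = true
c ≟L c = true
_ ≟L _ = false

count : Letter → List Letter → ℕ
count x []      = 0
count x (y ∷ w) = if x ≟L y then suc (count x w) else count x w

Excursion : List Letter → Set
Excursion w =
  ((n : ℕ) → count a (take n w) + count b (take n w) ≤ 2 * count c (take n w))
  × (count a w + count b w ≡ 2 * count c w)

-- Tree-growing maps, encoded combinatorially (rotation system).
-- Half-edges are 0 … nH-1, vertices are 0 … nV-1 (values of the
-- functions outside these ranges are irrelevant).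
--   vert h   : endpoint of half-edge h
--   cw h     : half-edge following h clockwise around its endpoint
--   opp h    : the other half of the edge containing h; legs are exactly
--              the half-edges with opp h ≡ h
--   root     : the root half-edge;  head : the head (a leg)
--   parent v : parent of vertex v in the distinguished spanning tree T
--              (nothing for the root-vertex); T is rooted at vert root.

record TGMap : Set where
  field
    nV nH  : ℕ
    vert   : ℕ → ℕ
    cw     : ℕ → ℕ
    opp    : ℕ → ℕ
    root   : ℕ
    head   : ℕ
    parent : ℕ → Maybe ℕ
open TGMap public

upd : {A : Set} → (ℕ → A) → ℕ → A → ℕ → A
upd f k x h = if h ≡ᵇ k then x else f h

isLeg : TGMap → ℕ → Bool
isLeg M h = opp M h ≡ᵇ h

-- one step of the tour of a face with the face on the left:
-- go to the other end of the current half-edge (stay, for a leg), then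
-- turn clockwise to the next half-edge around that vertex.
faceNext : TGMap → ℕ → ℕ
faceNext M d = cw M (opp M d)

tourFrom : TGMap → ℕ → ℕ → List ℕ
tourFrom M zero    d = []
tourFrom M (suc k) d =
  if d ≡ᵇ head M then [] else d ∷ tourFrom M k (faceNext M d)

headTour : TGMap → List ℕ
headTour M = tourFrom M (nH M) (faceNext M (head M))

tourLegs : TGMap → List ℕ
tourLegs M = filterᵇ (isLeg M) (headTour M)

firstLeg lastLeg : TGMap → Maybe ℕ
firstLeg M = headL (tourLegs M)
lastLeg  M = lastL (tourLegs M)

data Anc (M : TGMap) (u : ℕ) : ℕ → Set where
  here : Anc M u u
  up   : ∀ {v p} → parent M v ≡ just p → Anc M u p → Anc M u v

M0 : TGMap
M0 = record
  { nV = 1 ; nH = 2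
  ; vert = λ _ → 0
  ; cw = λ h → if h ≡ᵇ 0 then 1 else 0
  ; opp = λ h → h
  ; root = 0 ; head = 1
  ; parent = λ _ → nothing }

-- New vertex v = nV; new half-edges p = nH (glued to the old
-- head), nh = nH+1 (new head), l = nH+2 (new leg).
-- φ_a: counterclockwise order at v is nh, l, p (leg at the left of the head),
--      i.e. clockwise nh → p → l → nh.
-- φ_b: counterclockwise order at v is nh, p, l (leg at the right of the head),
--      i.e. clockwise nh → l → p → nh.
grow : (ℕ → ℕ → ℕ → ℕ → ℕ) → TGMap → TGMap
grow rot M = record
  { nV = suc (nV M) ; nH = nH M + 3
  ; vert = upd (upd (upd (vert M) p v) nh v) l v
  ; cw = upd (upd (upd (cw M) p (rot p nh l p)) nh (rot p nh l nh)) l (rot p nh l l)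
  ; opp = upd (upd (upd (upd (opp M) h p) p h) nh nh) l l
  ; root = root M ; head = nh
  ; parent = upd (parent M) v (just (vert M h)) }
  where
    h = head M
    v = nV M
    p = nH M
    nh = suc (nH M)
    l = suc (suc (nH M))

rotA rotB : ℕ → ℕ → ℕ → ℕ → ℕ
rotA p nh l x = if x ≡ᵇ nh then p else if x ≡ᵇ p then l else nh
rotB p nh l x = if x ≡ᵇ nh then l else if x ≡ᵇ l then p else nh

φa φb : TGMap → TGMap
φa = grow rotA
φb = grow rotB

glue : TGMap → ℕ → ℕ → TGMap
glue M s t = record M
  { opp = upd (upd (opp M) (head M) s) s (head M)
  ; head = t }

-- φ_c as a (partial) operation: Cstep M M' iff the defining condition of
-- φ_c holds at M and M' = φ_c(M).
Cstep : TGMap → TGMap → Set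
Cstep M M' = Σ ℕ λ f → Σ ℕ λ l → Σ ℕ λ s → Σ ℕ λ t →
    firstLeg M ≡ just f × lastLeg M ≡ just l
  × ((s ≡ f × t ≡ l) ⊎ (s ≡ l × t ≡ f))
  × vert M s ≢ vert M t
  × Anc M (vert M s) (vert M t)
  × M' ≡ glue M s t

Step : Letter → TGMap → TGMap → Set
Step a M M' = M' ≡ φa M
Step b M M' = M' ≡ φb M
Step c M M' = Cstep M M'

-- Reaches w M : the computation of φ_w(M⁰_•) succeeds with result M,
-- where φ_{a₁⋯aₘ} = φ_{a₁} ∘ ⋯ ∘ φ_{aₘ} (aₘ applied first).
data Reaches : List Letter → TGMap → Set where
  start : Reaches [] M0
  step  : ∀ {x w M M'} → Reaches w M → Step x M M' → Reaches (x ∷ w) M'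

ReadyToClose : TGMap → Set
ReadyToClose M =
  head M < nH M × opp M (head M) ≡ head M ×
  (Σ ℕ λ ℓ → ℓ < nH M × opp M ℓ ≡ ℓ × ℓ ≢ head M × ℓ ∈ headTour M
     × ((h : ℕ) → h < nH M → opp M h ≡ h → h ≡ head M ⊎ h ≡ ℓ))

{-# OPTIONS --safe #-}
module Submission where

-- We follow φ_w(M⁰_•) letter by letter, from the right end of w, and maintain an invariant of
-- the current tree-growing map. The head-face is toured, starting after the head, along an explicit
-- list of half-edges; the legs met on this tour sit at pairwise distinct vertices of the tree path
-- from the root-vertex to the head-vertex, and in tour order they first climb towards the root and
-- then descend again (a valley).
-- φa and φb put a new deepest leg at the end, resp. the start, of the valley. In a valley every leg
-- other than the first and the last one is an ancestor of one of them, and the first and last legs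
-- are comparable, so φc is defined. Gluing the head to the shallower of the two splits the head-face;
-- the part that keeps the deeper one, now the head, contains all remaining legs, and they again form
-- a valley above it.
-- Each a or b adds a leg and each c removes two, so 1 + |w|_a + |w|_b − 2|w|_c legs remain besides
-- the head. For an excursion, the suffix starting at any c leaves at least three legs when that c is
-- applied, and at the end exactly one leg is left.

open import Defs
open import Data.Bool using (Bool; true; false; T; T?)
open import Data.List using (List; []; _∷_; _++_; _∷ʳ_; [_]; length; filter; filterᵇ; take; drop)
  renaming (head to headL; last to lastL)
open import Data.List.Base using (initLast; _∷ʳ′_)
open import Data.List.Properties
  using ( ∷-injective; ++-assoc; ++-identityʳ; length-++; length-++-comm; length-++-sucʳ
        ; length-++-≤ˡ; length-++-≤ʳ; filter-accept; filter-reject; filter-none; filter-++; take++drop≡id )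
open import Data.List.Membership.Propositional using (_∈_)
open import Data.List.Membership.Propositional.Properties using (∈-filter⁻; ∈-filter⁺; ∈-++⁺ˡ; ∈-++⁺ʳ; ∈-++⁻)
open import Data.List.Relation.Unary.All as All using (All; []; _∷_)
import Data.List.Relation.Unary.All.Properties as All
open import Data.List.Relation.Unary.AllPairs as AllPairs using (AllPairs; []; _∷_)
import Data.List.Relation.Unary.AllPairs.Properties as AllPairs
open import Data.List.Relation.Unary.Any using (here; there)
open import Data.Maybe using (just)
open import Data.Maybe.Properties using (just-injective)
open import Data.Nat using (ℕ; suc; _+_; _*_; _≤_; _<_; _≡ᵇ_; z≤n; s≤s; z<s)
open import Data.Nat.Properties
  using ( _≟_; ≡ᵇ⇒≡; ≡⇒≡ᵇ; <⇒≢; ≤∧≢⇒<; ≤-pred; n≤1+n; n<1+n; m<n⇒m<1+n; m≤n⇒m<n∨m≡n; m≤m+n; m<m+n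
        ; <-≤-trans; ≤-<-trans; +-comm; +-suc; *-suc; *-distribˡ-+; +-monoˡ-≤; +-monoˡ-<
        ; +-cancelˡ-≤; +-cancelʳ-≤; +-cancelʳ-≡; +-commutativeSemigroup; module ≤-Reasoning )
open import Algebra.Properties.CommutativeSemigroup +-commutativeSemigroup using (interchange)
open import Data.Product using (Σ; ∃; ∃₂; _×_; _,_; proj₁; proj₂)
import Data.Product as Product
open import Data.Sum using (_⊎_; inj₁; inj₂)
open import Data.Unit using (tt)
open import Function using (_∘_; flip)
open import Relation.Binary.PropositionalEquality
  using (_≡_; _≢_; refl; sym; trans; cong; cong₂; subst; subst₂; ≢-sym; module ≡-Reasoning)
open import Relation.Nullary using (¬_; yes; no; contradiction)
open import Relation.Nullary.Decidable using (dec-true; dec-false)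
open import Relation.Unary using (Decidable; ∁)

≡ᵇ-refl : ∀ n → (n ≡ᵇ n) ≡ true
≡ᵇ-refl n = dec-true (n ≟ n) refl

≢⇒≡ᵇ≡false : ∀ {m n} → m ≢ n → (m ≡ᵇ n) ≡ false
≢⇒≡ᵇ≡false {m} {n} = dec-false (m ≟ n)

upd-self : ∀ {A : Set} (g : ℕ → A) k x → upd g k x k ≡ x
upd-self g k x rewrite ≡ᵇ-refl k = refl

upd-other : ∀ {A : Set} (g : ℕ → A) {k} x {h} → h ≢ k → upd g k x h ≡ g h
upd-other g x h≢k rewrite ≢⇒≡ᵇ≡false h≢k = refl

upd³ : {A : Set} → (ℕ → A) → ℕ → A → A → A → ℕ → A
upd³ g N α β γ = upd (upd (upd g N α) (suc N) β) (suc (suc N)) γ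

module _ {A : Set} (g : ℕ → A) (N : ℕ) {α β γ : A} where

  private
    g₁ g₂ : ℕ → A
    g₁ = upd g N α
    g₂ = upd g₁ (suc N) β

  upd³-below : ∀ {x} → x < N → upd³ g N α β γ x ≡ g x
  upd³-below x<N =
    trans (upd-other g₂ γ (<⇒≢ (m<n⇒m<1+n (m<n⇒m<1+n x<N))))
      (trans (upd-other g₁ β (<⇒≢ (m<n⇒m<1+n x<N))) (upd-other g α (<⇒≢ x<N)))

  upd³-at₀ : upd³ g N α β γ N ≡ α
  upd³-at₀ =
    trans (upd-other g₂ γ (<⇒≢ (m<n⇒m<1+n (n<1+n N))))
      (trans (upd-other g₁ β (<⇒≢ (n<1+n N))) (upd-self g N α))

  upd³-at₁ : upd³ g N α β γ (suc N) ≡ β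
  upd³-at₁ = trans (upd-other g₂ γ (<⇒≢ (n<1+n (suc N)))) (upd-self g₁ (suc N) β)

  upd³-at₂ : upd³ g N α β γ (suc (suc N)) ≡ γ
  upd³-at₂ = upd-self g₂ (suc (suc N)) γ

data Grown (N : ℕ) : ℕ → Set where
  old  : ∀ {x} → x < N → Grown N x
  new₀ : Grown N N
  new₁ : Grown N (suc N)
  new₂ : Grown N (suc (suc N))

grown : ∀ N {x} → x < N + 3 → Grown N x
grown N {x} x<N+3 with m≤n⇒m<n∨m≡n (≤-pred (subst (x <_) (+-comm N 3) x<N+3))
... | inj₂ refl = new₂
... | inj₁ x<2+N with m≤n⇒m<n∨m≡n (≤-pred x<2+N)
...   | inj₂ refl = new₁
...   | inj₁ x<1+N with m≤n⇒m<n∨m≡n (≤-pred x<1+N)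
...     | inj₂ refl = new₀
...     | inj₁ x<N = old x<N

grown< : ∀ {N x} → Grown N x → x < N + 3
grown< {N} (old x<N) = <-≤-trans x<N (m≤m+n N 3)
grown< {N} new₀ = m<m+n N z<s
grown< {N} new₁ = subst (suc N <_) (+-comm 3 N) (s≤s (s≤s (n≤1+n N)))
grown< {N} new₂ = subst (suc (suc N) <_) (+-comm 3 N) (n<1+n (suc (suc N)))

data Walk {A : Set} (next : A → A) : A → List A → A → Set where
  []  : ∀ {d} → Walk next d [] d
  _∷_ : ∀ {e xs} d → Walk next (next d) xs e → Walk next d (d ∷ xs) e

module _ {A : Set} {next : A → A} where

  Walk-start : ∀ {d d′ xs e} → d ≡ d′ → Walk next d′ xs e → Walk next d xs e
  Walk-start refl w = w

  Walk-step : ∀ {d d′ xs e} → next d ≡ d′ → Walk next d′ xs e → Walk next d (d ∷ xs) e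
  Walk-step refl w = _ ∷ w

  Walk-++ : ∀ {d xs e ys g} → Walk next d xs e → Walk next e ys g → Walk next d (xs ++ ys) g
  Walk-++ [] w′ = w′
  Walk-++ (d ∷ w) w′ = d ∷ Walk-++ w w′

  Walk-split : ∀ {d y ys e} xs → Walk next d (xs ++ y ∷ ys) e → Walk next d xs y × Walk next (next y) ys e
  Walk-split [] (_ ∷ w) = [] , w
  Walk-split (x ∷ xs) (_ ∷ w) = Product.map₁ (x ∷_) (Walk-split xs w)

Walk-cong : ∀ {A : Set} {f g : A → A} {d xs e} → All (λ x → g x ≡ f x) xs → Walk f d xs e → Walk g d xs e
Walk-cong [] [] = []
Walk-cong (eq ∷ eqs) (_ ∷ w) = Walk-step eq (Walk-cong eqs w)

tourFrom-walk : ∀ M {k d xs} → Walk (faceNext M) d xs (head M) → All (_≢ head M) xs →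
                length xs < k → tourFrom M k d ≡ xs
tourFrom-walk M {suc k} [] [] _ rewrite ≡ᵇ-refl (head M) = refl
tourFrom-walk M {suc k} (d ∷ w) (d≢h ∷ ds) (s≤s len) rewrite ≢⇒≡ᵇ≡false d≢h =
  cong (d ∷_) (tourFrom-walk M w ds len)

filterᵇ-cong : ∀ {A : Set} {p q : A → Bool} {xs} → All (λ x → p x ≡ q x) xs → filterᵇ p xs ≡ filterᵇ q xs
filterᵇ-cong [] = refl
filterᵇ-cong {p = p} {q} {x ∷ xs} (_ ∷ eqs) with p x | q x | filterᵇ-cong eqs
... | true  | true  | eq = cong (x ∷_) eq
... | false | false | eq = eq

module _ {A : Set} {P : A → Set} (P? : Decidable P) where

  filter-[]⁻ : ∀ xs → filter P? xs ≡ [] → All (∁ P) xs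
  filter-[]⁻ [] _ = []
  filter-[]⁻ (x ∷ xs) eq with P? x
  filter-[]⁻ (x ∷ xs) eq  | no ¬px = ¬px ∷ filter-[]⁻ xs eq
  filter-[]⁻ (x ∷ xs) () | yes _

  filter-∷⁻ : ∀ xs {y ys} → filter P? xs ≡ y ∷ ys →
              ∃₂ λ A X → xs ≡ A ++ y ∷ X × All (∁ P) A × filter P? X ≡ ys
  filter-∷⁻ (x ∷ xs) eq with P? x
  ... | yes _ with ∷-injective eq
  ...   | refl , eq′ = [] , xs , refl , [] , eq′
  filter-∷⁻ (x ∷ xs) eq | no ¬px with filter-∷⁻ xs eq
  ... | A , X , refl , ¬A , eq′ = x ∷ A , X , refl , ¬px ∷ ¬A , eq′

  filter-∷ʳ⁻ : ∀ xs {ys y} → filter P? xs ≡ ys ∷ʳ y →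
               ∃₂ λ X C → xs ≡ X ++ y ∷ C × filter P? X ≡ ys × All (∁ P) C
  filter-∷ʳ⁻ [] {[]} ()
  filter-∷ʳ⁻ [] {_ ∷ _} ()
  filter-∷ʳ⁻ (x ∷ xs) {ys} eq with P? x | ys
  ... | no ¬px | _ with filter-∷ʳ⁻ xs eq
  ...   | X , C , refl , eq′ , ¬C = x ∷ X , C , refl , trans (filter-reject P? ¬px) eq′ , ¬C
  filter-∷ʳ⁻ (x ∷ xs) eq | yes _ | [] with ∷-injective eq
  ... | refl , eq′ = [] , xs , refl , refl , filter-[]⁻ xs eq′
  filter-∷ʳ⁻ (x ∷ xs) eq | yes px | _ ∷ _ with ∷-injective eq
  ... | refl , eq′ with filter-∷ʳ⁻ xs eq′
  ...   | X , C , refl , eq″ , ¬C = x ∷ X , C , refl , trans (filter-accept P? px) (cong (x ∷_) eq″) , ¬C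

last-∷ʳ : ∀ {A : Set} (xs : List A) y → lastL (xs ∷ʳ y) ≡ just y
last-∷ʳ [] y = refl
last-∷ʳ (x ∷ []) y = refl
last-∷ʳ (x ∷ x′ ∷ xs) y = last-∷ʳ (x′ ∷ xs) y

length-∷ʳ : ∀ {A : Set} (xs : List A) y → length (xs ∷ʳ y) ≡ suc (length xs)
length-∷ʳ [] y = refl
length-∷ʳ (x ∷ xs) y = cong suc (length-∷ʳ xs y)

two≤length : ∀ {A : Set} {xs : List A} {x y : A} → headL xs ≡ just x → lastL xs ≡ just y → x ≢ y → 2 ≤ length xs
two≤length {xs = _ ∷ []} refl refl x≢y = contradiction refl x≢y
two≤length {xs = _ ∷ _ ∷ _} _ _ _ = s≤s (s≤s z≤n)

length≡1⇒singleton : ∀ {A : Set} (xs : List A) → length xs ≡ 1 → ∃ λ x → xs ≡ [ x ]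
length≡1⇒singleton (x ∷ []) _ = x , refl

module _ {A : Set} {R : A → A → Set} where

  AllPairs-∷ʳ⁻ : ∀ xs {y} → AllPairs R (xs ∷ʳ y) → AllPairs R xs × All (λ x → R x y) xs
  AllPairs-∷ʳ⁻ [] _ = [] , []
  AllPairs-∷ʳ⁻ (x ∷ xs) (rx ∷ rs) =
    let rs′ , rsy = AllPairs-∷ʳ⁻ xs rs
        rx′ , rxy = All.∷ʳ⁻ rx
    in rx′ ∷ rs′ , rxy ∷ rsy

  AllPairs-∷ʳ⁺ : ∀ {xs y} → All (λ x → R x y) xs → AllPairs R xs → AllPairs R (xs ∷ʳ y)
  AllPairs-∷ʳ⁺ rsy rs = AllPairs.++⁺ rs ([] ∷ []) (All.map (_∷ []) rsy)

  AllPairs-mapWith : ∀ {S : A → A → Set} {P : A → Set} {xs} → All P xs →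
                     (∀ {x y} → P x → P y → R x y → S x y) → AllPairs R xs → AllPairs S xs
  AllPairs-mapWith [] f [] = []
  AllPairs-mapWith (px ∷ ps) f (rx ∷ rs) =
    All.zipWith (λ (py , r) → f px py r) (ps , rx) ∷ AllPairs-mapWith ps f rs

-- Along the list the elements first go up (R y x for x before y), then down (R x y).
data Valley {A : Set} (R : A → A → Set) : List A → Set where
  valley : ∀ {D U} → AllPairs (flip R) D → AllPairs R U → Valley R (D ++ U)

module _ {A : Set} {R : A → A → Set} where

  valley-∷ : ∀ {L y} → All (λ x → R x y) L → Valley R L → Valley R (y ∷ L)
  valley-∷ below (valley {D} d u) = valley (All.++⁻ˡ D below ∷ d) u

  valley-∷ʳ : ∀ {L y} → All (λ x → R x y) L → Valley R L → Valley R (L ∷ʳ y)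
  valley-∷ʳ {y = y} below (valley {D} {U} d u) =
    subst (Valley R) (sym (++-assoc D U [ y ])) (valley d (AllPairs-∷ʳ⁺ (All.++⁻ʳ D below) u))

  valley-map : ∀ {S : A → A → Set} {P : A → Set} {L} → All P L →
               (∀ {x y} → P x → P y → R x y → S x y) → Valley R L → Valley S L
  valley-map ps f (valley {D} d u) =
    valley (AllPairs-mapWith (All.++⁻ˡ D ps) (λ px py → f py px) d)
           (AllPairs-mapWith (All.++⁻ʳ D ps) f u)

  valley-peel : ∀ {L} → 2 ≤ length L → Valley R L →
                ∃₂ λ f l → ∃ λ B → L ≡ f ∷ (B ∷ʳ l) × Valley R B × All (λ x → R x f ⊎ R x l) B
  valley-peel _ (valley {f ∷ D} {U} (df ∷ d) u) with initLast U
  ... | U′ ∷ʳ′ l =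
    let u′ , ul = AllPairs-∷ʳ⁻ U′ u
    in f , l , D ++ U′ , cong (f ∷_) (sym (++-assoc D U′ [ l ])) , valley d u′ ,
       All.++⁺ (All.map inj₁ df) (All.map inj₂ ul)
  ... | [] with initLast D
  ...   | D′ ∷ʳ′ l =
    let d′ , _ = AllPairs-∷ʳ⁻ D′ d
    in f , l , D′ , ++-identityʳ _ , subst (Valley R) (++-identityʳ D′) (valley d′ []) ,
       All.map inj₁ (proj₁ (All.∷ʳ⁻ df))
  valley-peel (s≤s ()) (valley {f ∷ .[]} {.[]} _ _) | [] | []
  valley-peel _ (valley {[]} {f ∷ U} [] (_ ∷ u)) with initLast U
  ... | U′ ∷ʳ′ l =
    let u′ , ul = AllPairs-∷ʳ⁻ U′ u
    in f , l , U′ , refl , valley {D = []} [] u′ , All.map inj₂ ul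
  valley-peel (s≤s ()) (valley {[]} {f ∷ .[]} _ _) | []
  valley-peel () (valley {[]} {[]} _ _)

Anc-trans : ∀ {M u v x} → Anc M u v → Anc M v x → Anc M u x
Anc-trans p here = p
Anc-trans p (up e q) = up e (Anc-trans p q)

Anc-comparable : ∀ {M u u′ x} → Anc M u x → Anc M u′ x → Anc M u u′ ⊎ Anc M u′ u
Anc-comparable here q = inj₂ q
Anc-comparable (up e p) here = inj₁ (up e p)
Anc-comparable (up e p) (up e′ q) with just-injective (trans (sym e) e′)
... | refl = Anc-comparable p q

Anc-glue : ∀ {M s t u x} → Anc M u x → Anc (glue M s t) u x
Anc-glue here = here
Anc-glue (up e p) = up e (Anc-glue p)

Above : TGMap → ℕ → ℕ → Set
Above M x y = Anc M (vert M x) (vert M y)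

record Invariant (M : TGMap) : Set where
  field
    tour legs              : List ℕ
    head<nH                : head M < nH M
    head-leg               : opp M (head M) ≡ head M
    tour-walk              : Walk (faceNext M) (faceNext M (head M)) tour (head M)
    tour≢head              : All (_≢ head M) tour
    tour<nH                : All (_< nH M) tour
    length-tour<nH         : length tour < nH M
    tour-legs              : filterᵇ (isLeg M) tour ≡ legs
    legs-complete          : ∀ x → x < nH M → opp M x ≡ x → x ≡ head M ⊎ x ∈ legs
    legs-distinct-vertices : AllPairs (λ x y → vert M x ≢ vert M y) legs
    legs-above-head        : All (λ x → Above M x (head M)) legs
    legs-valley            : Valley (Above M) legs
    -- φa and φb write only at the fresh indices nH, nH+1, nH+2 and nV, so these keep the old part intact
    opp<nH                 : ∀ x → x < nH M → opp M x < nH M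
    vert<nV                : ∀ x → x < nH M → vert M x < nV M
    parent<nV              : ∀ x {p} → x < nV M → parent M x ≡ just p → p < nV M

  headTour≡tour : headTour M ≡ tour
  headTour≡tour = tourFrom-walk M tour-walk tour≢head length-tour<nH

  tourLegs≡legs : tourLegs M ≡ legs
  tourLegs≡legs = trans (cong (filterᵇ (isLeg M)) headTour≡tour) tour-legs

  leg-on-tour : ∀ {x} → x ∈ legs → x ∈ tour × opp M x ≡ x
  leg-on-tour x∈legs =
    Product.map₂ (≡ᵇ⇒≡ _ _) (∈-filter⁻ (T? ∘ isLeg M) (subst (_ ∈_) (sym tour-legs) x∈legs))

  legs-on-tour : ∀ {P : ℕ → Set} → All P tour → All P legs
  legs-on-tour ps = All.tabulate (λ x∈legs → All.lookup ps (proj₁ (leg-on-tour x∈legs)))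

M0-invariant : Invariant M0
M0-invariant = record
  { tour = [ 0 ] ; legs = [ 0 ]
  ; head<nH = s≤s (s≤s z≤n) ; head-leg = refl
  ; tour-walk = 0 ∷ []
  ; tour≢head = (λ ()) ∷ [] ; tour<nH = z<s ∷ [] ; length-tour<nH = s≤s (s≤s z≤n)
  ; tour-legs = refl
  ; legs-complete = λ { 0 _ _ → inj₂ (here refl) ; 1 _ _ → inj₁ refl
                     ; (suc (suc _)) (s≤s (s≤s ())) _ }
  ; legs-distinct-vertices = [] ∷ []
  ; legs-above-head = here ∷ []
  ; legs-valley = valley {D = []} [] ([] ∷ [])
  ; opp<nH = λ _ x<2 → x<2
  ; vert<nV = λ _ _ → z<s
  ; parent<nV = λ _ _ () }

filter-leg : ∀ M x xs → opp M x ≡ x → filterᵇ (isLeg M) (x ∷ xs) ≡ x ∷ filterᵇ (isLeg M) xs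
filter-leg M x xs leg = filter-accept (T? ∘ isLeg M) (≡⇒≡ᵇ (opp M x) x leg)

filter-nonleg : ∀ M x xs → opp M x ≢ x → filterᵇ (isLeg M) (x ∷ xs) ≡ filterᵇ (isLeg M) xs
filter-nonleg M x xs ¬leg = filter-reject (T? ∘ isLeg M) (¬leg ∘ ≡ᵇ⇒≡ (opp M x) x)

module Grow (rot : ℕ → ℕ → ℕ → ℕ → ℕ) {M : TGMap} (I : Invariant M) where
  open Invariant I

  M′ : TGMap
  M′ = grow rot M

  N v h : ℕ
  N = nH M
  v = nV M
  h = head M

  rot′ : ℕ → ℕ
  rot′ = rot N (suc N) (suc (suc N))

  h≢N : h ≢ N
  h≢N = <⇒≢ head<nH

  opp-old : ∀ {x} → x < N → x ≢ h → opp M′ x ≡ opp M x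
  opp-old x<N x≢h = trans (upd³-below (upd (opp M) h N) N x<N) (upd-other (opp M) N x≢h)

  opp-head : opp M′ h ≡ N
  opp-head = trans (upd³-below (upd (opp M) h N) N head<nH) (upd-self (opp M) h N)

  opp-new₀ : opp M′ N ≡ h
  opp-new₀ = upd³-at₀ (upd (opp M) h N) N

  opp-new₁ : opp M′ (suc N) ≡ suc N
  opp-new₁ = upd³-at₁ (upd (opp M) h N) N

  opp-new₂ : opp M′ (suc (suc N)) ≡ suc (suc N)
  opp-new₂ = upd³-at₂ (upd (opp M) h N) N

  head-not-leg : opp M′ h ≢ h
  head-not-leg e = h≢N (trans (sym e) opp-head)

  new₀-not-leg : opp M′ N ≢ N
  new₀-not-leg e = h≢N (trans (sym opp-new₀) e)

  vert-old : ∀ {x} → x < N → vert M′ x ≡ vert M x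
  vert-old = upd³-below (vert M) N

  vert-new₁ : vert M′ (suc N) ≡ v
  vert-new₁ = upd³-at₁ (vert M) N

  vert-new₂ : vert M′ (suc (suc N)) ≡ v
  vert-new₂ = upd³-at₂ (vert M) N

  faceNext-old : ∀ {x} → x < N → x ≢ h → faceNext M′ x ≡ faceNext M x
  faceNext-old x<N x≢h = trans (cong (cw M′) (opp-old x<N x≢h)) (upd³-below (cw M) N (opp<nH _ x<N))

  faceNext-new₀ : faceNext M′ N ≡ faceNext M h
  faceNext-new₀ = trans (cong (cw M′) opp-new₀) (trans (upd³-below (cw M) N head<nH) (cong (cw M) (sym head-leg)))

  faceNext-head : faceNext M′ h ≡ rot′ N
  faceNext-head = trans (cong (cw M′) opp-head) (upd³-at₀ (cw M) N)

  faceNext-new₁ : faceNext M′ (suc N) ≡ rot′ (suc N)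
  faceNext-new₁ = trans (cong (cw M′) opp-new₁) (upd³-at₁ (cw M) N)

  faceNext-new₂ : faceNext M′ (suc (suc N)) ≡ rot′ (suc (suc N))
  faceNext-new₂ = trans (cong (cw M′) opp-new₂) (upd³-at₂ (cw M) N)

  tour-walk′ : Walk (faceNext M′) (faceNext M h) tour h
  tour-walk′ = Walk-cong (All.zipWith (λ (x<N , x≢h) → faceNext-old x<N x≢h) (tour<nH , tour≢head)) tour-walk

  tour-legs′ : filterᵇ (isLeg M′) tour ≡ legs
  tour-legs′ = trans (filterᵇ-cong (All.zipWith (λ (x<N , x≢h) → cong (_≡ᵇ _) (opp-old x<N x≢h))
                                                (tour<nH , tour≢head)))
                     tour-legs

  length-tour′ : length tour + 3 < N + 3
  length-tour′ = +-monoˡ-< 3 length-tour<nH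

  legs<N : All (_< N) legs
  legs<N = legs-on-tour tour<nH

  legs-complete′ : ∀ {L} → suc (suc N) ∈ L → (∀ {x} → x ∈ legs → x ∈ L) →
                   ∀ x → x < N + 3 → opp M′ x ≡ x → x ≡ suc N ⊎ x ∈ L
  legs-complete′ new∈L legs⊆L x x< e with grown N x<
  ... | new₀ = contradiction e new₀-not-leg
  ... | new₁ = inj₁ refl
  ... | new₂ = inj₂ new∈L
  ... | old x<N with x ≟ h
  ...   | yes refl = contradiction e head-not-leg
  ...   | no x≢h with legs-complete x x<N (trans (sym (opp-old x<N x≢h)) e)
  ...     | inj₁ x≡h = contradiction x≡h x≢h
  ...     | inj₂ x∈legs = inj₂ (legs⊆L x∈legs)

  opp<nH′ : ∀ x → x < N + 3 → opp M′ x < N + 3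
  opp<nH′ x x< with grown N x<
  ... | new₀ = subst (_< N + 3) (sym opp-new₀) (grown< (old head<nH))
  ... | new₁ = subst (_< N + 3) (sym opp-new₁) (grown< new₁)
  ... | new₂ = subst (_< N + 3) (sym opp-new₂) (grown< new₂)
  ... | old x<N with x ≟ h
  ...   | yes refl = subst (_< N + 3) (sym opp-head) (grown< new₀)
  ...   | no x≢h = subst (_< N + 3) (sym (opp-old x<N x≢h)) (grown< (old (opp<nH x x<N)))

  vert<nV′ : ∀ x → x < N + 3 → vert M′ x < suc v
  vert<nV′ x x< with grown N x<
  ... | old x<N = subst (_< suc v) (sym (vert-old x<N)) (m<n⇒m<1+n (vert<nV x x<N))
  ... | new₀ = subst (_< suc v) (sym (upd³-at₀ (vert M) N)) (n<1+n v)
  ... | new₁ = subst (_< suc v) (sym vert-new₁) (n<1+n v)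
  ... | new₂ = subst (_< suc v) (sym vert-new₂) (n<1+n v)

  parent<nV′ : ∀ x {p} → x < suc v → parent M′ x ≡ just p → p < suc v
  parent<nV′ x x≤v e with x ≟ v
  ... | yes refl = subst (_< suc v) (just-injective (trans (sym (upd-self (parent M) v (just (vert M h)))) e))
                         (m<n⇒m<1+n (vert<nV h head<nH))
  ... | no x≢v = m<n⇒m<1+n (parent<nV x (≤∧≢⇒< (≤-pred x≤v) x≢v)
                                     (trans (sym (upd-other (parent M) _ x≢v)) e))

  Anc-grow : ∀ {u x} → x < v → Anc M u x → Anc M′ u x
  Anc-grow x<v here = here
  Anc-grow {x = x} x<v (up e p) =
    up (trans (upd-other (parent M) _ (<⇒≢ x<v)) e) (Anc-grow (parent<nV x x<v e) p)

  Above-grow : ∀ {x y} → x < N → y < N → Above M x y → Above M′ x y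
  Above-grow x<N y<N p rewrite vert-old x<N | vert-old y<N = Anc-grow (vert<nV _ y<N) p

  legs-above-new : ∀ y → vert M′ y ≡ v → All (λ x → Above M′ x y) legs
  legs-above-new y vy≡v = All.zipWith
    (λ (x<N , x↑h) → subst₂ (Anc M′) (sym (vert-old x<N)) (sym vy≡v)
                             (up (upd-self (parent M) v (just (vert M h))) (Anc-grow (vert<nV h head<nH) x↑h)))
    (legs<N , legs-above-head)

  new-above-new : ∀ x y → vert M′ x ≡ v → vert M′ y ≡ v → Above M′ x y
  new-above-new x y vx≡v vy≡v = subst₂ (Anc M′) (sym vx≡v) (sym vy≡v) here

  legs-distinct′ : AllPairs (λ x y → vert M′ x ≢ vert M′ y) legs
  legs-distinct′ = AllPairs-mapWith legs<N
    (λ x<N y<N → subst₂ _≢_ (sym (vert-old x<N)) (sym (vert-old y<N))) legs-distinct-vertices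

  legs-avoid-new : ∀ y → vert M′ y ≡ v → All (λ x → vert M′ x ≢ vert M′ y) legs
  legs-avoid-new y vy≡v = All.map
    (λ {x} x<N → subst₂ _≢_ (sym (vert-old x<N)) (sym vy≡v) (<⇒≢ (vert<nV x x<N))) legs<N

  legs-valley′ : Valley (Above M′) legs
  legs-valley′ = valley-map legs<N Above-grow legs-valley

φa-invariant : ∀ {M} → Invariant M → Invariant (φa M)
φa-invariant {M} I = record
  { tour = N ∷ (tour ++ h ∷ suc (suc N) ∷ [])
  ; legs = legs ∷ʳ suc (suc N)
  ; head<nH = grown< new₁
  ; head-leg = opp-new₁
  ; tour-walk = Walk-start (trans faceNext-new₁ rotA-new₁) (Walk-step faceNext-new₀
      (Walk-++ tour-walk′ (Walk-step (trans faceNext-head rotA-new₀)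
                          (Walk-step (trans faceNext-new₂ rotA-new₂) []))))
  ; tour≢head = <⇒≢ (n<1+n N)
      ∷ All.++⁺ (All.map (<⇒≢ ∘ m<n⇒m<1+n) tour<nH)
                (<⇒≢ (m<n⇒m<1+n head<nH) ∷ ≢-sym (<⇒≢ (n<1+n (suc N))) ∷ [])
  ; tour<nH = grown< new₀ ∷ All.++⁺ (All.map (grown< ∘ old) tour<nH) (grown< (old head<nH) ∷ grown< new₂ ∷ [])
  ; length-tour<nH = subst (_< N + 3) (trans (+-suc _ 2) (cong suc (sym (length-++ tour)))) length-tour′
  ; tour-legs = tour-legs-a
  ; legs-complete = legs-complete′ (∈-++⁺ʳ legs (here refl)) ∈-++⁺ˡ
  ; legs-distinct-vertices = AllPairs-∷ʳ⁺ (legs-avoid-new (suc (suc N)) vert-new₂) legs-distinct′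
  ; legs-above-head = All.∷ʳ⁺ (legs-above-new (suc N) vert-new₁) (new-above-new (suc (suc N)) (suc N) vert-new₂ vert-new₁)
  ; legs-valley = valley-∷ʳ (legs-above-new (suc (suc N)) vert-new₂) legs-valley′
  ; opp<nH = opp<nH′
  ; vert<nV = vert<nV′
  ; parent<nV = parent<nV′ }
  where
    open Invariant I
    open Grow rotA I

    rotA-new₁ : rot′ (suc N) ≡ N
    rotA-new₁ rewrite ≡ᵇ-refl N = refl

    rotA-new₀ : rot′ N ≡ suc (suc N)
    rotA-new₀ rewrite ≢⇒≡ᵇ≡false (<⇒≢ (n<1+n N)) | ≡ᵇ-refl N = refl

    rotA-new₂ : rot′ (suc (suc N)) ≡ suc N
    rotA-new₂ rewrite ≢⇒≡ᵇ≡false (≢-sym (<⇒≢ (n<1+n N))) | ≢⇒≡ᵇ≡false (≢-sym (<⇒≢ (m<n⇒m<1+n (n<1+n N)))) = refl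

    tour-legs-a : filterᵇ (isLeg M′) (N ∷ (tour ++ h ∷ suc (suc N) ∷ [])) ≡ legs ∷ʳ suc (suc N)
    tour-legs-a = begin
      filterᵇ (isLeg M′) (N ∷ (tour ++ h ∷ suc (suc N) ∷ []))
        ≡⟨ filter-nonleg M′ N _ new₀-not-leg ⟩
      filterᵇ (isLeg M′) (tour ++ h ∷ suc (suc N) ∷ [])
        ≡⟨ filter-++ (T? ∘ isLeg M′) tour _ ⟩
      filterᵇ (isLeg M′) tour ++ filterᵇ (isLeg M′) (h ∷ suc (suc N) ∷ [])
        ≡⟨ cong₂ _++_ tour-legs′ (trans (filter-nonleg M′ h _ head-not-leg)
                                        (filter-leg M′ (suc (suc N)) [] opp-new₂)) ⟩
      legs ∷ʳ suc (suc N) ∎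
      where open ≡-Reasoning

φb-invariant : ∀ {M} → Invariant M → Invariant (φb M)
φb-invariant {M} I = record
  { tour = suc (suc N) ∷ N ∷ (tour ++ [ h ])
  ; legs = suc (suc N) ∷ legs
  ; head<nH = grown< new₁
  ; head-leg = opp-new₁
  ; tour-walk = Walk-start (trans faceNext-new₁ rotB-new₁) (Walk-step (trans faceNext-new₂ rotB-new₂)
      (Walk-step faceNext-new₀ (Walk-++ tour-walk′ (Walk-step (trans faceNext-head rotB-new₀) []))))
  ; tour≢head = ≢-sym (<⇒≢ (n<1+n (suc N))) ∷ <⇒≢ (n<1+n N)
      ∷ All.++⁺ (All.map (<⇒≢ ∘ m<n⇒m<1+n) tour<nH) (<⇒≢ (m<n⇒m<1+n head<nH) ∷ [])
  ; tour<nH = grown< new₂ ∷ grown< new₀ ∷ All.++⁺ (All.map (grown< ∘ old) tour<nH) (grown< (old head<nH) ∷ [])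
  ; length-tour<nH = subst (_< N + 3) (trans (+-suc _ 2) (cong suc (trans (+-suc _ 1) (cong suc (sym (length-++ tour))))))
                           length-tour′
  ; tour-legs = tour-legs-b
  ; legs-complete = legs-complete′ (here refl) there
  ; legs-distinct-vertices = All.map ≢-sym (legs-avoid-new (suc (suc N)) vert-new₂) ∷ legs-distinct′
  ; legs-above-head = new-above-new (suc (suc N)) (suc N) vert-new₂ vert-new₁ ∷ legs-above-new (suc N) vert-new₁
  ; legs-valley = valley-∷ (legs-above-new (suc (suc N)) vert-new₂) legs-valley′
  ; opp<nH = opp<nH′
  ; vert<nV = vert<nV′
  ; parent<nV = parent<nV′ }
  where
    open Invariant I
    open Grow rotB I

    rotB-new₁ : rot′ (suc N) ≡ suc (suc N)
    rotB-new₁ rewrite ≡ᵇ-refl N = refl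

    rotB-new₂ : rot′ (suc (suc N)) ≡ N
    rotB-new₂ rewrite ≢⇒≡ᵇ≡false (≢-sym (<⇒≢ (n<1+n N))) | ≡ᵇ-refl N = refl

    rotB-new₀ : rot′ N ≡ suc N
    rotB-new₀ rewrite ≢⇒≡ᵇ≡false (<⇒≢ (n<1+n N)) | ≢⇒≡ᵇ≡false (<⇒≢ (m<n⇒m<1+n (n<1+n N))) = refl

    tour-legs-b : filterᵇ (isLeg M′) (suc (suc N) ∷ N ∷ (tour ++ [ h ])) ≡ suc (suc N) ∷ legs
    tour-legs-b = begin
      filterᵇ (isLeg M′) (suc (suc N) ∷ N ∷ (tour ++ [ h ]))
        ≡⟨ filter-leg M′ (suc (suc N)) _ opp-new₂ ⟩
      suc (suc N) ∷ filterᵇ (isLeg M′) (N ∷ (tour ++ [ h ]))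
        ≡⟨ cong (suc (suc N) ∷_) (filter-nonleg M′ N _ new₀-not-leg) ⟩
      suc (suc N) ∷ filterᵇ (isLeg M′) (tour ++ [ h ])
        ≡⟨ cong (suc (suc N) ∷_) (filter-++ (T? ∘ isLeg M′) tour _) ⟩
      suc (suc N) ∷ (filterᵇ (isLeg M′) tour ++ filterᵇ (isLeg M′) [ h ])
        ≡⟨ cong (suc (suc N) ∷_) (cong₂ _++_ tour-legs′ (filter-nonleg M′ h [] head-not-leg)) ⟩
      suc (suc N) ∷ (legs ++ [])
        ≡⟨ cong (suc (suc N) ∷_) (++-identityʳ legs) ⟩
      suc (suc N) ∷ legs ∎
      where open ≡-Reasoning

record HeadFaceSplit {M : TGMap} (I : Invariant M) : Set where
  open Invariant I
  field
    f l         : ℕ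
    A B Y C     : List ℕ
    legs≡       : legs ≡ f ∷ (B ∷ʳ l)
    tour≡       : tour ≡ A ++ f ∷ (Y ++ l ∷ C)
    A-nonlegs   : All (∁ (T ∘ isLeg M)) A
    Y-legs      : filterᵇ (isLeg M) Y ≡ B
    C-nonlegs   : All (∁ (T ∘ isLeg M)) C
    B-valley    : Valley (Above M) B
    B-above-ends : All (λ x → Above M x f ⊎ Above M x l) B

head-face-split : ∀ {M} (I : Invariant M) → 2 ≤ length (Invariant.legs I) → HeadFaceSplit I
head-face-split {M} I 2≤legs
  with valley-peel 2≤legs (Invariant.legs-valley I)
... | f , l , B , legs≡ , B-valley , B-above-ends
  with filter-∷⁻ (T? ∘ isLeg M) (Invariant.tour I) (trans (Invariant.tour-legs I) legs≡)
... | A , X , tour≡ , A-nonlegs , X-legs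
  with filter-∷ʳ⁻ (T? ∘ isLeg M) X X-legs
... | Y , C , refl , Y-legs , C-nonlegs = record
  { f = f ; l = l ; A = A ; B = B ; Y = Y ; C = C
  ; legs≡ = legs≡ ; tour≡ = tour≡
  ; A-nonlegs = A-nonlegs ; Y-legs = Y-legs ; C-nonlegs = C-nonlegs
  ; B-valley = B-valley ; B-above-ends = B-above-ends }

module Gluing {M : TGMap} {I : Invariant M} (S : HeadFaceSplit I) where
  open Invariant I
  open HeadFaceSplit S

  h : ℕ
  h = head M

  f∈legs : f ∈ legs
  f∈legs = subst (f ∈_) (sym legs≡) (here refl)

  l∈legs : l ∈ legs
  l∈legs = subst (l ∈_) (sym legs≡) (there (∈-++⁺ʳ B (here refl)))

  f-leg : opp M f ≡ f
  f-leg = proj₂ (leg-on-tour f∈legs)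

  l-leg : opp M l ≡ l
  l-leg = proj₂ (leg-on-tour l∈legs)

  f<nH : f < nH M
  f<nH = All.lookup tour<nH (proj₁ (leg-on-tour f∈legs))

  l<nH : l < nH M
  l<nH = All.lookup tour<nH (proj₁ (leg-on-tour l∈legs))

  f≢h : f ≢ h
  f≢h = All.lookup tour≢head (proj₁ (leg-on-tour f∈legs))

  l≢h : l ≢ h
  l≢h = All.lookup tour≢head (proj₁ (leg-on-tour l∈legs))

  legs-distinct : AllPairs (λ x y → vert M x ≢ vert M y) (f ∷ (B ∷ʳ l))
  legs-distinct = subst (AllPairs _) legs≡ legs-distinct-vertices

  vf≢vl : vert M f ≢ vert M l
  vf≢vl = proj₂ (All.∷ʳ⁻ (AllPairs.head legs-distinct))

  f≢l : f ≢ l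
  f≢l = vf≢vl ∘ cong (vert M)

  B-distinct : AllPairs (λ x y → vert M x ≢ vert M y) B
  B-distinct = proj₁ (AllPairs-∷ʳ⁻ B (AllPairs.tail legs-distinct))

  B-inner : All (λ x → x ≢ f × x ≢ l) B
  B-inner = All.zipWith (λ (vf≢vx , vx≢vl) → (λ { refl → vf≢vx refl }) , (λ { refl → vx≢vl refl }))
    (proj₁ (All.∷ʳ⁻ (AllPairs.head legs-distinct)) , proj₂ (AllPairs-∷ʳ⁻ B (AllPairs.tail legs-distinct)))

  other-legs : ∀ {x} → x ∈ legs → x ≡ f ⊎ x ∈ B ⊎ x ≡ l
  other-legs x∈legs with subst (_ ∈_) legs≡ x∈legs
  ... | here x≡f = inj₁ x≡f
  ... | there x∈B∷ʳl with ∈-++⁻ B x∈B∷ʳl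
  ...   | inj₁ x∈B = inj₂ (inj₁ x∈B)
  ...   | inj₂ (here x≡l) = inj₂ (inj₂ x≡l)

  record Inner (x : ℕ) : Set where
    field
      bounded : x < nH M
      ≢head   : x ≢ h
      ≢first  : x ≢ f
      ≢last   : x ≢ l
  open Inner

  tour-inner : ∀ {x} → x ∈ tour → x ≢ f → x ≢ l → Inner x
  tour-inner x∈tour x≢f x≢l = record
    { bounded = All.lookup tour<nH x∈tour ; ≢head = All.lookup tour≢head x∈tour
    ; ≢first = x≢f ; ≢last = x≢l }

  nonleg-inner : ∀ {x} → x ∈ tour → ¬ T (isLeg M x) → Inner x
  nonleg-inner x∈tour ¬leg = tour-inner x∈tour
    (λ { refl → ¬leg (≡⇒≡ᵇ _ _ f-leg) }) (λ { refl → ¬leg (≡⇒≡ᵇ _ _ l-leg) })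

  A-inner : All Inner A
  A-inner = All.tabulate λ x∈A →
    nonleg-inner (subst (_ ∈_) (sym tour≡) (∈-++⁺ˡ x∈A)) (All.lookup A-nonlegs x∈A)

  Y-inner : All Inner Y
  Y-inner = All.tabulate λ {x} x∈Y → inner x∈Y (subst (_ ∈_) (sym tour≡) (∈-++⁺ʳ A (there (∈-++⁺ˡ x∈Y))))
    where
      inner : ∀ {x} → x ∈ Y → x ∈ tour → Inner x
      inner {x} x∈Y x∈tour with T? (isLeg M x)
      ... | no ¬leg = nonleg-inner x∈tour ¬leg
      ... | yes leg = let x∈B = subst (_ ∈_) Y-legs (∈-filter⁺ (T? ∘ isLeg M) x∈Y leg)
                      in tour-inner x∈tour (proj₁ (All.lookup B-inner x∈B)) (proj₂ (All.lookup B-inner x∈B))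

  C-inner : All Inner C
  C-inner = All.tabulate λ x∈C →
    nonleg-inner (subst (_ ∈_) (sym tour≡) (∈-++⁺ʳ A (there (∈-++⁺ʳ Y (there x∈C))))) (All.lookup C-nonlegs x∈C)

  walk-AfYlC : Walk (faceNext M) (faceNext M h) (A ++ f ∷ (Y ++ l ∷ C)) h
  walk-AfYlC = subst (λ xs → Walk (faceNext M) (faceNext M h) xs h) tour≡ tour-walk

  walk-A : Walk (faceNext M) (faceNext M h) A f
  walk-A = proj₁ (Walk-split A walk-AfYlC)

  walk-Y : Walk (faceNext M) (faceNext M f) Y l
  walk-Y = proj₁ (Walk-split Y (proj₂ (Walk-split A walk-AfYlC)))

  walk-C : Walk (faceNext M) (faceNext M l) C h
  walk-C = proj₂ (Walk-split Y (proj₂ (Walk-split A walk-AfYlC)))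

  module Glued (s t : ℕ) (s-leg : opp M s ≡ s) (s<nH : s < nH M) (s≢h : s ≢ h)
               (inner⇒≢s : ∀ {x} → Inner x → x ≢ s) where

    M′ : TGMap
    M′ = glue M s t

    opp-other : ∀ {x} → x ≢ h → x ≢ s → opp M′ x ≡ opp M x
    opp-other x≢h x≢s = trans (upd-other (upd (opp M) h s) h x≢s) (upd-other (opp M) s x≢h)

    opp-head : opp M′ h ≡ s
    opp-head = trans (upd-other (upd (opp M) h s) h (s≢h ∘ sym)) (upd-self (opp M) h s)

    opp-s : opp M′ s ≡ h
    opp-s = upd-self (upd (opp M) h s) s h

    -- Gluing exchanges the face-successors of the head and of s: the head-face splits in two.
    faceNext-head : faceNext M′ h ≡ faceNext M s
    faceNext-head = cong (cw M) (trans opp-head (sym s-leg))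

    faceNext-s : faceNext M′ s ≡ faceNext M h
    faceNext-s = cong (cw M) (trans opp-s (sym head-leg))

    kept-walk : ∀ {d xs e} → All Inner xs → Walk (faceNext M) d xs e → Walk (faceNext M′) d xs e
    kept-walk inner = Walk-cong (All.map (λ i → cong (cw M) (opp-other (≢head i) (inner⇒≢s i))) inner)

    kept-legs : ∀ {xs} → All Inner xs → filterᵇ (isLeg M′) xs ≡ filterᵇ (isLeg M) xs
    kept-legs inner = filterᵇ-cong (All.map (λ i → cong (_≡ᵇ _) (opp-other (≢head i) (inner⇒≢s i))) inner)

    no-legs : ∀ {xs} → All Inner xs → All (∁ (T ∘ isLeg M)) xs → filterᵇ (isLeg M′) xs ≡ []
    no-legs inner nonlegs = trans (kept-legs inner) (filter-none (T? ∘ isLeg M) nonlegs)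

    opp<nH′ : ∀ x → x < nH M → opp M′ x < nH M
    opp<nH′ x x<nH with x ≟ s | x ≟ h
    ... | yes refl | _ = subst (_< nH M) (sym opp-s) head<nH
    ... | no _ | yes refl = subst (_< nH M) (sym opp-head) s<nH
    ... | no x≢s | no x≢h = subst (_< nH M) (sym (opp-other x≢h x≢s)) (opp<nH x x<nH)

    legs-complete′ : ∀ x → x < nH M → opp M′ x ≡ x → x ≢ s × (x ≡ f ⊎ x ∈ B ⊎ x ≡ l)
    legs-complete′ x x<nH leg with x ≟ s | x ≟ h
    ... | yes refl | _ = contradiction (trans (sym leg) opp-s) s≢h
    ... | no _ | yes refl = contradiction (trans (sym opp-head) leg) s≢h
    ... | no x≢s | no x≢h with legs-complete x x<nH (trans (sym (opp-other x≢h x≢s)) leg)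
    ...   | inj₁ x≡h = contradiction x≡h x≢h
    ...   | inj₂ x∈legs = x≢s , other-legs x∈legs

    B-valley′ : Valley (Above M′) B
    B-valley′ = valley-map (All.universal (λ _ → tt) B) (λ _ _ → Anc-glue) B-valley

  glue-fl : Above M f l → Invariant (glue M f l)
  glue-fl f↑l = record
    { tour = C ++ h ∷ Y
    ; legs = B
    ; head<nH = l<nH
    ; head-leg = trans (opp-other l≢h (≢-sym f≢l)) l-leg
    ; tour-walk = Walk-start (cong (cw M) (opp-other l≢h (≢-sym f≢l)))
        (Walk-++ (kept-walk C-inner walk-C) (Walk-step faceNext-head (kept-walk Y-inner walk-Y)))
    ; tour≢head = All.++⁺ (All.map ≢last C-inner) (≢-sym l≢h ∷ All.map ≢last Y-inner)
    ; tour<nH = All.++⁺ (All.map bounded C-inner) (head<nH ∷ All.map bounded Y-inner)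
    ; length-tour<nH = ≤-<-trans length≤ length-tour<nH
    ; tour-legs = tour-legs′
    ; legs-complete = legs-complete-fl
    ; legs-distinct-vertices = B-distinct
    ; legs-above-head = All.map (λ { (inj₁ x↑f) → Anc-glue (Anc-trans x↑f f↑l) ; (inj₂ x↑l) → Anc-glue x↑l }) B-above-ends
    ; legs-valley = B-valley′
    ; opp<nH = opp<nH′
    ; vert<nV = vert<nV
    ; parent<nV = parent<nV }
    where
      open Glued f l f-leg f<nH f≢h ≢first

      h-nonleg : opp M′ h ≢ h
      h-nonleg e = f≢h (trans (sym opp-head) e)

      length≤ : length (C ++ h ∷ Y) ≤ length tour
      length≤ = begin
        length (C ++ h ∷ Y)                ≡⟨ length-++-comm C (h ∷ Y) ⟩
        suc (length (Y ++ C))              ≡⟨ sym (length-++-sucʳ Y l C) ⟩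
        length (Y ++ l ∷ C)                ≤⟨ n≤1+n _ ⟩
        length (f ∷ (Y ++ l ∷ C))          ≤⟨ length-++-≤ʳ (f ∷ (Y ++ l ∷ C)) {A} ⟩
        length (A ++ f ∷ (Y ++ l ∷ C))     ≡⟨ cong length (sym tour≡) ⟩
        length tour                        ∎
        where open ≤-Reasoning

      tour-legs′ : filterᵇ (isLeg M′) (C ++ h ∷ Y) ≡ B
      tour-legs′ = begin
        filterᵇ (isLeg M′) (C ++ h ∷ Y)                       ≡⟨ filter-++ (T? ∘ isLeg M′) C _ ⟩
        filterᵇ (isLeg M′) C ++ filterᵇ (isLeg M′) (h ∷ Y)   ≡⟨ cong₂ _++_ (no-legs C-inner C-nonlegs)
                                                                  (filter-nonleg M′ h Y h-nonleg) ⟩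
        filterᵇ (isLeg M′) Y                                   ≡⟨ trans (kept-legs Y-inner) Y-legs ⟩
        B                                                      ∎
        where open ≡-Reasoning

      legs-complete-fl : ∀ x → x < nH M → opp M′ x ≡ x → x ≡ l ⊎ x ∈ B
      legs-complete-fl x x<nH leg with legs-complete′ x x<nH leg
      ... | x≢f , inj₁ x≡f = contradiction x≡f x≢f
      ... | _ , inj₂ (inj₁ x∈B) = inj₂ x∈B
      ... | _ , inj₂ (inj₂ x≡l) = inj₁ x≡l

  glue-lf : Above M l f → Invariant (glue M l f)
  glue-lf l↑f = record
    { tour = Y ++ l ∷ A
    ; legs = B
    ; head<nH = f<nH
    ; head-leg = trans (opp-other f≢h f≢l) f-leg
    ; tour-walk = Walk-start (cong (cw M) (opp-other f≢h f≢l))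
        (Walk-++ (kept-walk Y-inner walk-Y) (Walk-step faceNext-s (kept-walk A-inner walk-A)))
    ; tour≢head = All.++⁺ (All.map ≢first Y-inner) (≢-sym f≢l ∷ All.map ≢first A-inner)
    ; tour<nH = All.++⁺ (All.map bounded Y-inner) (l<nH ∷ All.map bounded A-inner)
    ; length-tour<nH = ≤-<-trans length≤ length-tour<nH
    ; tour-legs = tour-legs′
    ; legs-complete = legs-complete-lf
    ; legs-distinct-vertices = B-distinct
    ; legs-above-head = All.map (λ { (inj₁ x↑f) → Anc-glue x↑f ; (inj₂ x↑l) → Anc-glue (Anc-trans x↑l l↑f) }) B-above-ends
    ; legs-valley = B-valley′
    ; opp<nH = opp<nH′
    ; vert<nV = vert<nV
    ; parent<nV = parent<nV }
    where
      open Glued l f l-leg l<nH l≢h ≢last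

      l-nonleg : opp M′ l ≢ l
      l-nonleg e = l≢h (trans (sym e) opp-s)

      length≤ : length (Y ++ l ∷ A) ≤ length tour
      length≤ = begin
        length (Y ++ l ∷ A)                ≡⟨ length-++-comm Y (l ∷ A) ⟩
        suc (length (A ++ Y))              ≡⟨ sym (length-++-sucʳ A f Y) ⟩
        length (A ++ f ∷ Y)                ≤⟨ length-++-≤ˡ (A ++ f ∷ Y) ⟩
        length ((A ++ f ∷ Y) ++ l ∷ C)     ≡⟨ cong length (trans (++-assoc A (f ∷ Y) (l ∷ C)) (sym tour≡)) ⟩
        length tour                        ∎
        where open ≤-Reasoning

      tour-legs′ : filterᵇ (isLeg M′) (Y ++ l ∷ A) ≡ B
      tour-legs′ = begin
        filterᵇ (isLeg M′) (Y ++ l ∷ A)                       ≡⟨ filter-++ (T? ∘ isLeg M′) Y _ ⟩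
        filterᵇ (isLeg M′) Y ++ filterᵇ (isLeg M′) (l ∷ A)   ≡⟨ cong₂ _++_ (trans (kept-legs Y-inner) Y-legs)
                                                                  (trans (filter-nonleg M′ l A l-nonleg)
                                                                         (no-legs A-inner A-nonlegs)) ⟩
        B ++ []                                                ≡⟨ ++-identityʳ B ⟩
        B                                                      ∎
        where open ≡-Reasoning

      legs-complete-lf : ∀ x → x < nH M → opp M′ x ≡ x → x ≡ f ⊎ x ∈ B
      legs-complete-lf x x<nH leg with legs-complete′ x x<nH leg
      ... | _ , inj₁ x≡f = inj₁ x≡f
      ... | _ , inj₂ (inj₁ x∈B) = inj₂ x∈B
      ... | x≢l , inj₂ (inj₂ x≡l) = contradiction x≡l x≢l

  first-leg : firstLeg M ≡ just f
  first-leg = cong headL (trans tourLegs≡legs legs≡)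

  last-leg : lastLeg M ≡ just l
  last-leg = trans (cong lastL (trans tourLegs≡legs legs≡)) (last-∷ʳ (f ∷ B) l)

  length-legs : length legs ≡ 2 + length B
  length-legs = trans (cong length legs≡) (cong suc (length-∷ʳ B l))

  φc-applicable : ∃ (Cstep M)
  φc-applicable with Anc-comparable (All.lookup legs-above-head f∈legs) (All.lookup legs-above-head l∈legs)
  ... | inj₁ f↑l = glue M f l , f , l , f , l , first-leg , last-leg , inj₁ (refl , refl) , vf≢vl , f↑l , refl
  ... | inj₂ l↑f = glue M l f , f , l , l , f , first-leg , last-leg , inj₂ (refl , refl) , vf≢vl ∘ sym , l↑f , refl

  φc-invariant : ∀ {M′} → Cstep M M′ → Σ (Invariant M′) λ I′ → length legs ≡ 2 + length (Invariant.legs I′)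
  φc-invariant (f₀ , l₀ , s , t , first₀ , last₀ , ends , _ , s↑t , refl)
    with just-injective (trans (sym first₀) first-leg) | just-injective (trans (sym last₀) last-leg) | ends
  ... | refl | refl | inj₁ (refl , refl) = glue-fl s↑t , length-legs
  ... | refl | refl | inj₂ (refl , refl) = glue-lf s↑t , length-legs

ends-distinct : ∀ {M s t f l} → (s ≡ f × t ≡ l) ⊎ (s ≡ l × t ≡ f) → vert M s ≢ vert M t → f ≢ l
ends-distinct (inj₁ (refl , refl)) vs≢vt refl = vs≢vt refl
ends-distinct (inj₂ (refl , refl)) vs≢vt refl = vs≢vt refl

Cstep-two-legs : ∀ {M M′} (I : Invariant M) → Cstep M M′ → 2 ≤ length (Invariant.legs I)
Cstep-two-legs {M} I (_ , _ , _ , _ , first₀ , last₀ , ends , vs≢vt , _) =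
  two≤length (trans (cong headL (sym tourLegs≡legs)) first₀) (trans (cong lastL (sym tourLegs≡legs)) last₀)
             (ends-distinct {M} ends vs≢vt)
  where open Invariant I

count-++ : ∀ x u v → count x (u ++ v) ≡ count x u + count x v
count-++ x [] v = refl
count-++ x (y ∷ u) v with x ≟L y
... | true  = cong suc (count-++ x u v)
... | false = count-++ x u v

-- n = 1 + |w|_a + |w|_b − 2|w|_c, stated without truncated subtraction
LegCount : List Letter → ℕ → Set
LegCount w n = n + 2 * count c w ≡ suc (count a w + count b w)

m+2[1+k]≡2+m+2k : ∀ m k → m + 2 * suc k ≡ 2 + m + 2 * k
m+2[1+k]≡2+m+2k m k = trans (cong (m +_) (*-suc 2 k)) (trans (+-suc m _) (cong suc (+-suc m _)))

reachable-invariant : ∀ {w M} → Reaches w M → Σ (Invariant M) λ I → LegCount w (length (Invariant.legs I))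
reachable-invariant start = M0-invariant , refl
reachable-invariant (step {a} {w} r refl) with reachable-invariant r
... | I , count≡ = φa-invariant I , trans (cong (_+ 2 * count c w) (length-∷ʳ (Invariant.legs I) _)) (cong suc count≡)
reachable-invariant (step {b} {w} r refl) with reachable-invariant r
... | I , count≡ = φb-invariant I , cong suc (trans count≡ (sym (+-suc (count a w) (count b w))))
reachable-invariant (step {c} {w} r cstep) with reachable-invariant r
... | I , count≡ with Gluing.φc-invariant (head-face-split I (Cstep-two-legs I cstep)) cstep
... | I′ , length≡ = I′ , trans (m+2[1+k]≡2+m+2k _ (count c w)) (trans (cong (_+ 2 * count c w) (sym length≡)) count≡)

-- φ_w applies the letters of w from the right, so φc at an occurrence of c sees the suffix starting there.
SuffixBound : List Letter → Set
SuffixBound w = ∀ n → 2 * count c (drop n w) ≤ count a (drop n w) + count b (drop n w)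

two-legs-before-c : ∀ {w n} → LegCount w n → 2 * suc (count c w) ≤ count a w + count b w → 2 ≤ n
two-legs-before-c {w} {n} count≡ bound = +-cancelʳ-≤ (2 * count c w) 2 n (begin
  2 + 2 * count c w           ≡⟨ sym (*-suc 2 (count c w)) ⟩
  2 * suc (count c w)         ≤⟨ bound ⟩
  count a w + count b w       ≤⟨ n≤1+n _ ⟩
  suc (count a w + count b w) ≡⟨ sym count≡ ⟩
  n + 2 * count c w           ∎)
  where open ≤-Reasoning

reachable : ∀ w → SuffixBound w → ∃ (Reaches w)
reachable [] _ = M0 , start
reachable (a ∷ w) bound = Product.map φa (λ r → step r refl) (reachable w (bound ∘ suc))
reachable (b ∷ w) bound = Product.map φb (λ r → step r refl) (reachable w (bound ∘ suc))
reachable (c ∷ w) bound with reachable w (bound ∘ suc)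
... | M , r with reachable-invariant r
... | I , count≡ = Product.map₂ (step r) (Gluing.φc-applicable (head-face-split I (two-legs-before-c {w} count≡ (bound 0))))

excursion-suffix-bound : ∀ {w} → Excursion w → SuffixBound w
excursion-suffix-bound {w} (prefix-bound , balanced) n = +-cancelˡ-≤ (2 * count c p) _ _ (begin
  2 * count c p + 2 * count c s                     ≡⟨ sym (*-distribˡ-+ 2 (count c p) (count c s)) ⟩
  2 * (count c p + count c s)                       ≡⟨ cong (2 *_) (sym (split c)) ⟩
  2 * count c w                                     ≡⟨ sym balanced ⟩
  count a w + count b w                             ≡⟨ cong₂ _+_ (split a) (split b) ⟩
  (count a p + count a s) + (count b p + count b s) ≡⟨ interchange (count a p) (count a s) (count b p) (count b s) ⟩
  (count a p + count b p) + (count a s + count b s) ≤⟨ +-monoˡ-≤ _ (prefix-bound n) ⟩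
  2 * count c p + (count a s + count b s)           ∎)
  where
    p s : List Letter
    p = take n w
    s = drop n w
    split : ∀ x → count x w ≡ count x p + count x s
    split x = trans (cong (count x) (sym (take++drop≡id n w))) (count-++ x p s)
    open ≤-Reasoning

module _ {M : TGMap} (I : Invariant M) where
  open Invariant I

  ready-to-close : ∀ {ℓ} → legs ≡ [ ℓ ] → ReadyToClose M
  ready-to-close {ℓ} legs≡[ℓ] =
    head<nH , head-leg , ℓ , All.lookup tour<nH ℓ∈tour , proj₂ (leg-on-tour ℓ∈legs) ,
    All.lookup tour≢head ℓ∈tour , subst (ℓ ∈_) (sym headTour≡tour) ℓ∈tour , only-ℓ
    where
      ℓ∈legs : ℓ ∈ legs
      ℓ∈legs = subst (ℓ ∈_) (sym legs≡[ℓ]) (here refl)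

      ℓ∈tour : ℓ ∈ tour
      ℓ∈tour = proj₁ (leg-on-tour ℓ∈legs)

      only-ℓ : ∀ x → x < nH M → opp M x ≡ x → x ≡ head M ⊎ x ≡ ℓ
      only-ℓ x x<nH leg with legs-complete x x<nH leg
      ... | inj₁ x≡h = inj₁ x≡h
      ... | inj₂ x∈legs with subst (x ∈_) legs≡[ℓ] x∈legs
      ...   | here x≡ℓ = inj₂ x≡ℓ

reached-ready : ∀ {w M} → Excursion w → Reaches w M → ReadyToClose M
reached-ready {w} (_ , balanced) r with reachable-invariant r
... | I , count≡ with length≡1⇒singleton _ (+-cancelʳ-≡ (2 * count c w) _ 1 (trans count≡ (cong suc balanced)))
... | _ , legs≡[ℓ] = ready-to-close I legs≡[ℓ]

mainTheorem4 : (w : List Letter) → Excursion w →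
    (Σ TGMap λ M → Reaches w M) × ((M : TGMap) → Reaches w M → ReadyToClose M)
mainTheorem4 w excursion = reachable w (excursion-suffix-bound excursion) , λ _ → reached-ready excursion
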